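{- Let $a$ be a positive integer and suppose $a\,T_k(m)=(2m+1)^k$ with positive integers $k$ and $m>1$. If $a\equiv1\pmod 4$, then $\operatorname{ord}_2(am-1)=2+\operatorname{ord}_2 k$; if $a\equiv 3\pmod 4$, then $\operatorname{ord}_2(am-1)\ge 3+\operatorname{ord}_2 k$.
   Context: $T_k(m):=\sum_{j=1}^{m}(2j-1)^k$; $\operatorname{ord}_2$ denotes the $2$-adic valuation. -}

module Defs where

open import Data.Nat using (ℕ; zero; suc; _+_; _*_; _∸_; _^_)
open import Data.Nat.Divisibility using (_∣_)
open import Data.Product using (_×_)
open import Relation.Nullary using (¬_)

T : ℕ → ℕ → ℕ
T k zero = 0
T k (suc m) = T k m + (2 * suc m ∸ 1) ^ k

Ord2 : ℕ → ℕ → Set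
Ord2 n v = (2 ^ v ∣ n) × ¬ (2 ^ suc v ∣ n)

-- * v = 0 is impossible: the terms (2i + 1)^k and (2(m - 1 - i) + 1)^k add up to
--   a multiple of 2m for odd k, so m ∣ T k m, whereas (2m + 1)^k ≡ 1 (mod m).
-- * v = n + 1: if x² = 1 + 8b then repeated squaring gives
--   x^k ≡ 1 + 2^(n+3)·b (mod 2^(n+4)).  With x = 2i + 1 and b = tri i (a
--   triangular number) the equation becomes, after summing over i < m,
--     a·(m + 2^(n+3)·Σ_{i<m} tri i) ≡ 1 + 2^(n+3)·tri m  (mod 2^(n+4)).
--   Hence m is odd, the sum of triangular numbers is even, and
--   am - 1 ≡ 2^(n+3)·tri m (mod 2^(n+4)).  As tri m is odd exactly when
--   m ≡ 1 (mod 4), and am ≡ 1 (mod 4), the residue of a modulo 4 decides between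
--   ord₂(am - 1) = n + 3 and ord₂(am - 1) ≥ n + 4.

module Submission where

open import Defs
open import Data.Nat using (ℕ; zero; suc; _+_; _*_; _∸_; _^_; _≤_; _<_; _%_)
open import Data.Product using (_×_)
open import Relation.Binary.PropositionalEquality using (_≡_)

open import Data.Empty using (⊥; ⊥-elim)
open import Data.Integer using (ℤ; +_; -_)
  renaming (_+_ to _⊕_; _*_ to _⊗_; _-_ to _⊝_; _^_ to _^ᶻ_)
open import Data.Integer.Divisibility.Signed
  using (_∣_; divides; ∣-refl; ∣-trans; ∣m∣n⇒∣m+n; ∣m⇒∣-m; ∣n⇒∣m*n; ∣m⇒∣m*n; *-cancelˡ-∣; ∣⇒∣ᵤ; ∣ᵤ⇒∣;
         module ∣-Reasoning)
import Data.Integer.Properties as ℤP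
open import Data.Integer.Tactic.RingSolver using (solve)
open import Data.List using (_∷_; [])
open import Data.Nat using (s≤s; z≤n; _≤?_; _/_)
open import Data.Nat.Divisibility using () renaming (_∣_ to _∣ℕ_)
import Data.Nat.Divisibility as ℕDiv
import Data.Nat.DivMod as ℕDivMod
import Data.Nat.Properties as ℕP
import Data.Nat.Tactic.RingSolver as ℕSolver
open import Data.Product using (Σ; _,_; proj₁; map₁)
open import Data.Sum using (_⊎_; inj₁; inj₂; [_,_]′)
open import Function using (_$_)
open import Level using (0ℓ)
open import Relation.Binary.Bundles using (Setoid)
open import Relation.Binary.PropositionalEquality
  using (refl; sym; trans; cong; cong₂; subst; subst₂; module ≡-Reasoning)
open import Relation.Nullary using (¬_; yes; no)
open import Algebra.Properties.CommutativeSemigroup ℤP.+-commutativeSemigroup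
  using () renaming (interchange to +-interchange)

-- Congruence of integers modulo d: d divides the difference.  It is a
-- record rather than a plain synonym so that x, y and d can be inferred.
infix 4 _≡_mod_
record _≡_mod_ (x y d : ℤ) : Set where
  constructor mod-intro
  field difference : d ∣ x ⊝ y
open _≡_mod_ public

≡⇒≡mod : ∀ {d x y} → x ≡ y → x ≡ y mod d
≡⇒≡mod {d} {x} refl = mod-intro (divides (+ 0) (solve (x ∷ d ∷ [])))

mod-sym : ∀ {d x y} → x ≡ y mod d → y ≡ x mod d
mod-sym {d} {x} {y} (mod-intro x≡y) = mod-intro $ begin
  d         ∣⟨ ∣m⇒∣-m x≡y ⟩
  - (x ⊝ y) ≡⟨ solve (x ∷ y ∷ []) ⟩
  y ⊝ x     ∎
  where open ∣-Reasoning

mod-trans : ∀ {d x y z} → x ≡ y mod d → y ≡ z mod d → x ≡ z mod d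
mod-trans {d} {x} {y} {z} (mod-intro x≡y) (mod-intro y≡z) = mod-intro $ begin
  d                 ∣⟨ ∣m∣n⇒∣m+n x≡y y≡z ⟩
  (x ⊝ y) ⊕ (y ⊝ z) ≡⟨ solve (x ∷ y ∷ z ∷ []) ⟩
  x ⊝ z             ∎
  where open ∣-Reasoning

mod-setoid : ℤ → Setoid 0ℓ 0ℓ
mod-setoid d = record
  { Carrier = ℤ
  ; _≈_ = λ x y → x ≡ y mod d
  ; isEquivalence = record { refl = ≡⇒≡mod refl ; sym = mod-sym ; trans = mod-trans }
  }

module mod-Reasoning (d : ℤ) where
  open import Relation.Binary.Reasoning.Setoid (mod-setoid d) public

mod-+ : ∀ {d x x′ y y′} → x ≡ x′ mod d → y ≡ y′ mod d → x ⊕ y ≡ x′ ⊕ y′ mod d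
mod-+ {d} {x} {x′} {y} {y′} (mod-intro x≡x′) (mod-intro y≡y′) = mod-intro $ begin
  d                   ∣⟨ ∣m∣n⇒∣m+n x≡x′ y≡y′ ⟩
  (x ⊝ x′) ⊕ (y ⊝ y′) ≡⟨ solve (x ∷ x′ ∷ y ∷ y′ ∷ []) ⟩
  x ⊕ y ⊝ (x′ ⊕ y′)   ∎
  where open ∣-Reasoning

mod-+ʳ : ∀ {d x x′} z → x ≡ x′ mod d → x ⊕ z ≡ x′ ⊕ z mod d
mod-+ʳ z x≡x′ = mod-+ x≡x′ (≡⇒≡mod {x = z} refl)

mod-* : ∀ {d x x′ y y′} → x ≡ x′ mod d → y ≡ y′ mod d → x ⊗ y ≡ x′ ⊗ y′ mod d
mod-* {d} {x} {x′} {y} {y′} (mod-intro x≡x′) (mod-intro y≡y′) = mod-intro $ begin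
  d                             ∣⟨ ∣m∣n⇒∣m+n (∣n⇒∣m*n x y≡y′) (∣m⇒∣m*n y′ x≡x′) ⟩
  x ⊗ (y ⊝ y′) ⊕ (x ⊝ x′) ⊗ y′ ≡⟨ solve (x ∷ x′ ∷ y ∷ y′ ∷ []) ⟩
  x ⊗ y ⊝ x′ ⊗ y′               ∎
  where open ∣-Reasoning

mod-*ˡ : ∀ {d y y′} z → y ≡ y′ mod d → z ⊗ y ≡ z ⊗ y′ mod d
mod-*ˡ z = mod-* (≡⇒≡mod {x = z} refl)

mod-^ : ∀ {d x y} → x ≡ y mod d → ∀ e → x ^ᶻ e ≡ y ^ᶻ e mod d
mod-^ x≡y zero    = ≡⇒≡mod refl
mod-^ x≡y (suc e) = mod-* x≡y (mod-^ x≡y e)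

mod-divisor : ∀ {d d′ x y} → d′ ∣ d → x ≡ y mod d → x ≡ y mod d′
mod-divisor d′∣d (mod-intro d∣x-y) = mod-intro (∣-trans d′∣d d∣x-y)

mod-multiple : ∀ x t d → x ⊕ t ⊗ d ≡ x mod d
mod-multiple x t d = mod-intro (divides t (solve (x ∷ t ∷ d ∷ [])))

mod-witness : ∀ {d x y} → x ≡ y mod d → Σ ℤ (λ t → x ≡ y ⊕ t ⊗ d)
mod-witness {d} {x} {y} (mod-intro (divides t x-y≡td)) = t , (begin
  x             ≡⟨ solve (x ∷ y ∷ []) ⟩
  y ⊕ (x ⊝ y)   ≡⟨ cong (y ⊕_) x-y≡td ⟩
  y ⊕ t ⊗ d     ∎)
  where open ≡-Reasoning

mod-rewrite : ∀ {x x′ y y′ d d′} → x ≡ x′ → y ≡ y′ → d ≡ d′ → x ≡ y mod d → x′ ≡ y′ mod d′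
mod-rewrite refl refl refl x≡y = x≡y

∣-respects-mod : ∀ {d x y} → d ∣ x → x ≡ y mod d → d ∣ y
∣-respects-mod {d} {x} {y} d∣x (mod-intro x≡y) = begin
  d             ∣⟨ ∣m∣n⇒∣m+n d∣x (∣m⇒∣-m x≡y) ⟩
  x ⊕ - (x ⊝ y) ≡⟨ solve (x ∷ y ∷ []) ⟩
  y             ∎
  where open ∣-Reasoning

no-divisor-of-one : ∀ {d} → 1 < d → ¬ (+ d ∣ + 1)
no-divisor-of-one 1<d d∣1 = ℕP.<⇒≢ 1<d (sym (ℕDiv.∣1⇒≡1 (∣⇒∣ᵤ d∣1)))

∑ : (ℕ → ℤ) → ℕ → ℤ
∑ f zero    = + 0
∑ f (suc n) = ∑ f n ⊕ f n

∑-cong-mod : ∀ {d} f g n → (∀ i → i < n → f i ≡ g i mod d) → ∑ f n ≡ ∑ g n mod d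
∑-cong-mod f g zero    f≡g = ≡⇒≡mod refl
∑-cong-mod f g (suc n) f≡g =
  mod-+ (∑-cong-mod f g n (λ i i<n → f≡g i (ℕP.m<n⇒m<1+n i<n))) (f≡g n (ℕP.n<1+n n))

∑-divisible : ∀ {d} f n → (∀ i → i < n → d ∣ f i) → d ∣ ∑ f n
∑-divisible {d} f zero    d∣f = divides (+ 0) (solve (d ∷ []))
∑-divisible     f (suc n) d∣f =
  ∣m∣n⇒∣m+n (∑-divisible f n (λ i i<n → d∣f i (ℕP.m<n⇒m<1+n i<n))) (d∣f n (ℕP.n<1+n n))

∑-+ : ∀ f g n → ∑ (λ i → f i ⊕ g i) n ≡ ∑ f n ⊕ ∑ g n
∑-+ f g zero    = refl
∑-+ f g (suc n) = begin
  ∑ (λ i → f i ⊕ g i) n ⊕ (f n ⊕ g n)   ≡⟨ cong (_⊕ (f n ⊕ g n)) (∑-+ f g n) ⟩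
  (∑ f n ⊕ ∑ g n) ⊕ (f n ⊕ g n)         ≡⟨ +-interchange (∑ f n) (∑ g n) (f n) (g n) ⟩
  (∑ f n ⊕ f n) ⊕ (∑ g n ⊕ g n)         ∎
  where open ≡-Reasoning

∑-shift : ∀ f n → ∑ f (suc n) ≡ f 0 ⊕ ∑ (λ i → f (suc i)) n
∑-shift f zero    = ℤP.+-comm (+ 0) (f 0)
∑-shift f (suc n) = begin
  ∑ f (suc n) ⊕ f (suc n)                        ≡⟨ cong (_⊕ f (suc n)) (∑-shift f n) ⟩
  f 0 ⊕ ∑ (λ i → f (suc i)) n ⊕ f (suc n)        ≡⟨ ℤP.+-assoc (f 0) _ _ ⟩
  f 0 ⊕ (∑ (λ i → f (suc i)) n ⊕ f (suc n))      ∎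
  where open ≡-Reasoning

∑-reverse : ∀ f n → ∑ f n ≡ ∑ (λ i → f (n ∸ suc i)) n
∑-reverse f zero    = refl
∑-reverse f (suc n) = begin
  ∑ f n ⊕ f n                                    ≡⟨ cong (_⊕ f n) (∑-reverse f n) ⟩
  ∑ (λ i → f (n ∸ suc i)) n ⊕ f n                ≡⟨ ℤP.+-comm _ (f n) ⟩
  f n ⊕ ∑ (λ i → f (n ∸ suc i)) n                ≡⟨ ∑-shift (λ i → f (suc n ∸ suc i)) n ⟨
  ∑ (λ i → f (suc n ∸ suc i)) (suc n)            ∎
  where open ≡-Reasoning

∑-affine : ∀ c e f n → ∑ (λ i → c ⊕ e ⊗ f i) n ≡ + n ⊗ c ⊕ e ⊗ ∑ f n
∑-affine c e f zero    = solve (c ∷ e ∷ [])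
∑-affine c e f (suc n) = begin
  ∑ (λ i → c ⊕ e ⊗ f i) n ⊕ (c ⊕ e ⊗ f n)      ≡⟨ cong (_⊕ (c ⊕ e ⊗ f n)) (∑-affine c e f n) ⟩
  + n ⊗ c ⊕ e ⊗ ∑ f n ⊕ (c ⊕ e ⊗ f n)          ≡⟨ regroup (+ n) (∑ f n) (f n) ⟩
  (+ 1 ⊕ + n) ⊗ c ⊕ e ⊗ (∑ f n ⊕ f n)          ∎
  where
  open ≡-Reasoning
  regroup : ∀ N S x → N ⊗ c ⊕ e ⊗ S ⊕ (c ⊕ e ⊗ x) ≡ (+ 1 ⊕ N) ⊗ c ⊕ e ⊗ (S ⊕ x)
  regroup N S x = solve (N ∷ S ∷ x ∷ c ∷ e ∷ [])

even-or-odd : ∀ n → Σ ℕ (λ j → n ≡ 2 * j ⊎ n ≡ 1 + 2 * j)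
even-or-odd zero = 0 , inj₁ refl
even-or-odd (suc n) with even-or-odd n
... | j , inj₁ n≡2j = j , inj₂ (cong suc n≡2j)
... | j , inj₂ n≡1+2j = suc j , inj₁ (trans (cong suc n≡1+2j) (sym (ℕP.*-suc 2 j)))

odd-mod4 : ∀ j → Σ ℕ (λ r → 1 + 2 * j ≡ 1 + 4 * r ⊎ 1 + 2 * j ≡ 3 + 4 * r)
odd-mod4 j with even-or-odd j
... | r , inj₁ refl = r , inj₁ (double-twice r)
  where
  double-twice : ∀ r → 1 + 2 * (2 * r) ≡ 1 + 4 * r
  double-twice r = ℕSolver.solve (r ∷ [])
... | r , inj₂ refl = r , inj₂ (double-odd r)
  where
  double-odd : ∀ r → 1 + 2 * (1 + 2 * r) ≡ 3 + 4 * r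
  double-odd r = ℕSolver.solve (r ∷ [])

pos-^ : ∀ x e → + (x ^ e) ≡ (+ x) ^ᶻ e
pos-^ x zero    = refl
pos-^ x (suc e) = trans (ℤP.pos-* x (x ^ e)) (cong ((+ x) ⊗_) (pos-^ x e))

pos-pred : ∀ {n} → 1 ≤ n → + (n ∸ 1) ≡ + n ⊝ + 1
pos-pred {n} 1≤n = trans (sym (ℤP.⊖-≥ 1≤n)) (sym (ℤP.m-n≡m⊖n n 1))

pos-c+4r : ∀ c r → + (c + 4 * r) ≡ + c ⊕ + 4 ⊗ + r
pos-c+4r c r = trans (ℤP.pos-+ c (4 * r)) (cong (+ c ⊕_) (ℤP.pos-* 4 r))

odd : ℕ → ℤ
odd i = + (1 + 2 * i)

odd-ℤ : ∀ i → odd i ≡ + 1 ⊕ + 2 ⊗ + i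
odd-ℤ i = cong (+ 1 ⊕_) (ℤP.pos-* 2 i)

T-as-sum : ∀ k m → + T k m ≡ ∑ (λ i → odd i ^ᶻ k) m
T-as-sum k zero    = refl
T-as-sum k (suc m) = begin
  + (T k m + (2 * suc m ∸ 1) ^ k)            ≡⟨ ℤP.pos-+ (T k m) _ ⟩
  + T k m ⊕ + ((2 * suc m ∸ 1) ^ k)          ≡⟨ cong₂ _⊕_ (T-as-sum k m) (pos-^ _ k) ⟩
  ∑ (λ i → odd i ^ᶻ k) m ⊕ (+ (2 * suc m ∸ 1)) ^ᶻ k
                                             ≡⟨ cong (λ j → ∑ (λ i → odd i ^ᶻ k) m ⊕ (+ j) ^ᶻ k)
                                                     (cong (_∸ 1) (ℕP.*-suc 2 m)) ⟩
  ∑ (λ i → odd i ^ᶻ k) m ⊕ odd m ^ᶻ k        ∎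
  where open ≡-Reasoning

equation-in-ℤ : ∀ a k m → a * T k m ≡ (2 * m + 1) ^ k → + a ⊗ ∑ (λ i → odd i ^ᶻ k) m ≡ odd m ^ᶻ k
equation-in-ℤ a k m eqn = begin
  + a ⊗ ∑ (λ i → odd i ^ᶻ k) m   ≡⟨ cong (+ a ⊗_) (T-as-sum k m) ⟨
  + a ⊗ + T k m                  ≡⟨ ℤP.pos-* a (T k m) ⟨
  + (a * T k m)                  ≡⟨ cong +_ eqn ⟩
  + ((2 * m + 1) ^ k)            ≡⟨ pos-^ (2 * m + 1) k ⟩
  (+ (2 * m + 1)) ^ᶻ k          ≡⟨ cong (λ j → (+ j) ^ᶻ k) (ℕP.+-comm (2 * m) 1) ⟩
  odd m ^ᶻ k                     ∎
  where open ≡-Reasoning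

neg-odd-power : ∀ y h → (- y) ^ᶻ (1 + 2 * h) ≡ - (y ^ᶻ (1 + 2 * h))
neg-odd-power y h = begin
  (- y) ^ᶻ (1 + 2 * h)        ≡⟨ cong (- y ⊗_) (ℤP.^-*-assoc (- y) 2 h) ⟨
  - y ⊗ ((- y) ^ᶻ 2) ^ᶻ h     ≡⟨ cong (λ z → - y ⊗ z ^ᶻ h) square-neg ⟩
  - y ⊗ (y ^ᶻ 2) ^ᶻ h         ≡⟨ cong (- y ⊗_) (ℤP.^-*-assoc y 2 h) ⟩
  - y ⊗ y ^ᶻ (2 * h)          ≡⟨ ℤP.neg-distribˡ-* y _ ⟨
  - (y ^ᶻ (1 + 2 * h))        ∎
  where
  open ≡-Reasoning
  square-neg : - y ⊗ (- y ⊗ + 1) ≡ y ⊗ (y ⊗ + 1)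
  square-neg = solve (y ∷ [])

-- x + y divides x^e + y^e for odd e, because x ≡ -y modulo x + y.
odd-power-sum : ∀ x y h → x ⊕ y ∣ x ^ᶻ (1 + 2 * h) ⊕ y ^ᶻ (1 + 2 * h)
odd-power-sum x y h = begin
  x ⊕ y                   ∣⟨ difference (mod-trans (mod-^ x≡-y e) (≡⇒≡mod (neg-odd-power y h))) ⟩
  x ^ᶻ e ⊝ - (y ^ᶻ e)     ≡⟨ cong (x ^ᶻ e ⊕_) (ℤP.neg-involutive (y ^ᶻ e)) ⟩
  x ^ᶻ e ⊕ y ^ᶻ e         ∎
  where
  open ∣-Reasoning
  e = 1 + 2 * h
  x≡-y : x ≡ - y mod x ⊕ y
  x≡-y = mod-intro (divides (+ 1) (solve (x ∷ y ∷ [])))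

odd-pair : ∀ {i m} → i < m → odd i ⊕ odd (m ∸ suc i) ≡ + 2 ⊗ + m
odd-pair {i} {m} i<m = begin
  + ((1 + 2 * i) + (1 + 2 * j))   ≡⟨ cong +_ (regroup i j) ⟩
  + (2 * (suc i + j))             ≡⟨ cong (λ n → + (2 * n)) (ℕP.m+[n∸m]≡n i<m) ⟩
  + (2 * m)                       ≡⟨ ℤP.pos-* 2 m ⟩
  + 2 ⊗ + m                       ∎
  where
  open ≡-Reasoning
  j = m ∸ suc i
  regroup : ∀ i j → (1 + 2 * i) + (1 + 2 * j) ≡ 2 * (suc i + j)
  regroup i j = ℕSolver.solve (i ∷ j ∷ [])

-- For odd k the equation has no solution with m > 1: pairing the terms
-- of T k m shows m ∣ T k m, while (2m + 1)^k ≡ 1 (mod m); hence m ∣ 1.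
odd-exponent-impossible : ∀ a m h → 1 < m →
  a * T (1 + 2 * h) m ≡ (2 * m + 1) ^ (1 + 2 * h) → ⊥
odd-exponent-impossible a m h 1<m eqn = no-divisor-of-one 1<m m∣1
  where
  k = 1 + 2 * h
  f : ℕ → ℤ
  f i = odd i ^ᶻ k

  pair : ∀ i → i < m → + 2 ⊗ + m ∣ f i ⊕ f (m ∸ suc i)
  pair i i<m = subst (_∣ f i ⊕ f (m ∸ suc i)) (odd-pair i<m) (odd-power-sum (odd i) (odd (m ∸ suc i)) h)

  m∣sum : + m ∣ ∑ f m
  m∣sum = *-cancelˡ-∣ (+ 2) (begin
    + 2 ⊗ + m                                 ∣⟨ ∑-divisible _ m pair ⟩
    ∑ (λ i → f i ⊕ f (m ∸ suc i)) m           ≡⟨ ∑-+ f _ m ⟩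
    ∑ f m ⊕ ∑ (λ i → f (m ∸ suc i)) m         ≡⟨ cong (∑ f m ⊕_) (∑-reverse f m) ⟨
    ∑ f m ⊕ ∑ f m                             ≡⟨ double (∑ f m) ⟩
    + 2 ⊗ ∑ f m                               ∎)
    where
    open ∣-Reasoning
    double : ∀ S → S ⊕ S ≡ + 2 ⊗ S
    double S = solve (S ∷ [])

  odd≡1 : odd m ≡ + 1 mod + m
  odd≡1 = mod-intro (divides (+ 2) (trans (cong (_⊝ + 1) (odd-ℤ m)) (cancel-one (+ m))))
    where
    cancel-one : ∀ M → + 1 ⊕ + 2 ⊗ M ⊝ + 1 ≡ + 2 ⊗ M
    cancel-one M = solve (M ∷ [])

  m∣1 : + m ∣ + 1
  m∣1 = ∣-respects-mod (subst (+ m ∣_) (equation-in-ℤ a k m eqn) (∣n⇒∣m*n (+ a) m∣sum))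
                       (mod-trans (mod-^ odd≡1 k) (≡⇒≡mod (ℤP.^-zeroˡ k)))

triangle : ℕ → ℤ
triangle zero    = + 0
triangle (suc n) = triangle n ⊕ + suc n

triangle-closed : ∀ n → + 2 ⊗ triangle n ≡ + n ⊗ (+ n ⊕ + 1)
triangle-closed zero    = refl
triangle-closed (suc n) = begin
  + 2 ⊗ (triangle n ⊕ (+ 1 ⊕ + n))            ≡⟨ ℤP.*-distribˡ-+ (+ 2) (triangle n) _ ⟩
  + 2 ⊗ triangle n ⊕ + 2 ⊗ (+ 1 ⊕ + n)        ≡⟨ cong (_⊕ + 2 ⊗ (+ 1 ⊕ + n)) (triangle-closed n) ⟩
  + n ⊗ (+ n ⊕ + 1) ⊕ + 2 ⊗ (+ 1 ⊕ + n)       ≡⟨ regroup (+ n) ⟩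
  (+ 1 ⊕ + n) ⊗ ((+ 1 ⊕ + n) ⊕ + 1)           ∎
  where
  open ≡-Reasoning
  regroup : ∀ N → N ⊗ (N ⊕ + 1) ⊕ + 2 ⊗ (+ 1 ⊕ N) ≡ (+ 1 ⊕ N) ⊗ ((+ 1 ⊕ N) ⊕ + 1)
  regroup N = solve (N ∷ [])

odd-square : ∀ i → odd i ⊗ odd i ≡ + 1 ⊕ + 8 ⊗ triangle i
odd-square i = begin
  odd i ⊗ odd i                                 ≡⟨ cong₂ _⊗_ (odd-ℤ i) (odd-ℤ i) ⟩
  (+ 1 ⊕ + 2 ⊗ + i) ⊗ (+ 1 ⊕ + 2 ⊗ + i)         ≡⟨ expand (+ i) ⟩
  + 1 ⊕ + 4 ⊗ (+ i ⊗ (+ i ⊕ + 1))               ≡⟨ cong (λ z → + 1 ⊕ + 4 ⊗ z) (triangle-closed i) ⟨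
  + 1 ⊕ + 4 ⊗ (+ 2 ⊗ triangle i)                ≡⟨ cong (+ 1 ⊕_) (ℤP.*-assoc (+ 4) (+ 2) (triangle i)) ⟨
  + 1 ⊕ + 8 ⊗ triangle i                        ∎
  where
  open ≡-Reasoning
  expand : ∀ I → (+ 1 ⊕ + 2 ⊗ I) ⊗ (+ 1 ⊕ + 2 ⊗ I) ≡ + 1 ⊕ + 4 ⊗ (I ⊗ (I ⊕ + 1))
  expand I = solve (I ∷ [])

consecutive-triangles : ∀ n → triangle n ⊕ triangle (suc n) ≡ + suc n ⊗ + suc n
consecutive-triangles n = begin
  triangle n ⊕ (triangle n ⊕ (+ 1 ⊕ + n))      ≡⟨ regroup (triangle n) (+ n) ⟩
  + 2 ⊗ triangle n ⊕ (+ 1 ⊕ + n)               ≡⟨ cong (_⊕ (+ 1 ⊕ + n)) (triangle-closed n) ⟩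
  + n ⊗ (+ n ⊕ + 1) ⊕ (+ 1 ⊕ + n)              ≡⟨ square (+ n) ⟩
  (+ 1 ⊕ + n) ⊗ (+ 1 ⊕ + n)                    ∎
  where
  open ≡-Reasoning
  regroup : ∀ t N → t ⊕ (t ⊕ (+ 1 ⊕ N)) ≡ + 2 ⊗ t ⊕ (+ 1 ⊕ N)
  regroup t N = solve (t ∷ N ∷ [])
  square : ∀ N → N ⊗ (N ⊕ + 1) ⊕ (+ 1 ⊕ N) ≡ (+ 1 ⊕ N) ⊗ (+ 1 ⊕ N)
  square N = solve (N ∷ [])

triangle-sum-even : ∀ j → + 2 ∣ ∑ triangle (1 + 2 * j)
triangle-sum-even zero    = divides (+ 0) refl
triangle-sum-even (suc j) = subst (λ n → + 2 ∣ ∑ triangle n) (sym (cong suc (ℕP.*-suc 2 j))) (begin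
  + 2                                               ∣⟨ ∣m∣n⇒∣m+n (triangle-sum-even j) (∣m⇒∣m*n (+ suc n) 2∣n+1) ⟩
  ∑ triangle n ⊕ + suc n ⊗ + suc n                  ≡⟨ cong (∑ triangle n ⊕_) (consecutive-triangles n) ⟨
  ∑ triangle n ⊕ (triangle n ⊕ triangle (suc n))    ≡⟨ ℤP.+-assoc (∑ triangle n) _ _ ⟨
  ∑ triangle (2 + n)                                ∎)
  where
  open ∣-Reasoning
  n = 1 + 2 * j
  2∣n+1 : + 2 ∣ + suc n
  2∣n+1 = divides (+ suc j) (trans (cong +_ (even-successor j)) (ℤP.pos-* (suc j) 2))
    where
    even-successor : ∀ j → 2 + 2 * j ≡ suc j * 2
    even-successor j = ℕSolver.solve (j ∷ [])

halve-mod : ∀ {t c} X → + 2 ⊗ t ≡ + 2 ⊗ (c ⊕ X ⊗ + 2) → t ≡ c mod + 2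
halve-mod {t} {c} X eq =
  subst (_≡ c mod + 2) (sym (ℤP.*-cancelˡ-≡ (+ 2) t _ eq)) (mod-multiple c X (+ 2))

triangle-1mod4 : ∀ r → triangle (1 + 4 * r) ≡ + 1 mod + 2
triangle-1mod4 r = halve-mod (+ 3 ⊗ + r ⊕ + 4 ⊗ + r ⊗ + r) (begin
  + 2 ⊗ triangle (1 + 4 * r)                     ≡⟨ triangle-closed (1 + 4 * r) ⟩
  + (1 + 4 * r) ⊗ (+ (1 + 4 * r) ⊕ + 1)          ≡⟨ cong (λ M → M ⊗ (M ⊕ + 1)) (pos-c+4r 1 r) ⟩
  (+ 1 ⊕ + 4 ⊗ + r) ⊗ ((+ 1 ⊕ + 4 ⊗ + r) ⊕ + 1)  ≡⟨ expand (+ r) ⟩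
  + 2 ⊗ (+ 1 ⊕ (+ 3 ⊗ + r ⊕ + 4 ⊗ + r ⊗ + r) ⊗ + 2) ∎)
  where
  open ≡-Reasoning
  expand : ∀ R → (+ 1 ⊕ + 4 ⊗ R) ⊗ ((+ 1 ⊕ + 4 ⊗ R) ⊕ + 1) ≡ + 2 ⊗ (+ 1 ⊕ (+ 3 ⊗ R ⊕ + 4 ⊗ R ⊗ R) ⊗ + 2)
  expand R = solve (R ∷ [])

triangle-3mod4 : ∀ r → triangle (3 + 4 * r) ≡ + 0 mod + 2
triangle-3mod4 r = halve-mod (+ 3 ⊕ + 7 ⊗ + r ⊕ + 4 ⊗ + r ⊗ + r) (begin
  + 2 ⊗ triangle (3 + 4 * r)                     ≡⟨ triangle-closed (3 + 4 * r) ⟩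
  + (3 + 4 * r) ⊗ (+ (3 + 4 * r) ⊕ + 1)          ≡⟨ cong (λ M → M ⊗ (M ⊕ + 1)) (pos-c+4r 3 r) ⟩
  (+ 3 ⊕ + 4 ⊗ + r) ⊗ ((+ 3 ⊕ + 4 ⊗ + r) ⊕ + 1)  ≡⟨ expand (+ r) ⟩
  + 2 ⊗ (+ 0 ⊕ (+ 3 ⊕ + 7 ⊗ + r ⊕ + 4 ⊗ + r ⊗ + r) ⊗ + 2) ∎)
  where
  open ≡-Reasoning
  expand : ∀ R → (+ 3 ⊕ + 4 ⊗ R) ⊗ ((+ 3 ⊕ + 4 ⊗ R) ⊕ + 1) ≡ + 2 ⊗ (+ 0 ⊕ (+ 3 ⊕ + 7 ⊗ R ⊕ + 4 ⊗ R ⊗ R) ⊗ + 2)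
  expand R = solve (R ∷ [])

-- Lifted P b x: x ≡ 1 + 8Pb (mod 16P).  Squaring doubles P (lifting the
-- exponent at 2), and odd powers preserve the congruence.
Lifted : ℤ → ℤ → ℤ → Set
Lifted P b x = x ≡ + 1 ⊕ + 8 ⊗ P ⊗ b mod + 16 ⊗ P

-- Squaring doubles P: 1 + 8Pc squared is 1 + 16Pc + 64P²c².
square-lift : ∀ {P b x} → Lifted P b x → Lifted (+ 2 ⊗ P) b (x ⊗ x)
square-lift {P} {b} L with mod-witness L
... | t , refl = mod-intro (divides (t ⊕ + 2 ⊗ P ⊗ c ⊗ c) (expand P b t))
  where
  c = b ⊕ + 2 ⊗ t
  expand : ∀ P b t →
    (+ 1 ⊕ + 8 ⊗ P ⊗ b ⊕ t ⊗ (+ 16 ⊗ P)) ⊗ (+ 1 ⊕ + 8 ⊗ P ⊗ b ⊕ t ⊗ (+ 16 ⊗ P)) ⊝ (+ 1 ⊕ + 8 ⊗ (+ 2 ⊗ P) ⊗ b)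
    ≡ (t ⊕ + 2 ⊗ P ⊗ (b ⊕ + 2 ⊗ t) ⊗ (b ⊕ + 2 ⊗ t)) ⊗ (+ 16 ⊗ (+ 2 ⊗ P))
  expand P b t = solve (P ∷ b ∷ t ∷ [])

lifted-square-one : ∀ {P b x} → Lifted P b x → x ⊗ x ≡ + 1 mod + 16 ⊗ P
lifted-square-one {P} {b} L with mod-witness L
... | t , refl = mod-intro (divides (c ⊕ + 4 ⊗ P ⊗ c ⊗ c) (expand P b t))
  where
  c = b ⊕ + 2 ⊗ t
  expand : ∀ P b t →
    (+ 1 ⊕ + 8 ⊗ P ⊗ b ⊕ t ⊗ (+ 16 ⊗ P)) ⊗ (+ 1 ⊕ + 8 ⊗ P ⊗ b ⊕ t ⊗ (+ 16 ⊗ P)) ⊝ + 1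
    ≡ ((b ⊕ + 2 ⊗ t) ⊕ + 4 ⊗ P ⊗ (b ⊕ + 2 ⊗ t) ⊗ (b ⊕ + 2 ⊗ t)) ⊗ (+ 16 ⊗ P)
  expand P b t = solve (P ∷ b ∷ t ∷ [])

lifted-odd-power : ∀ {P b x} h → Lifted P b x → Lifted P b (x ^ᶻ (1 + 2 * h))
lifted-odd-power {P} {b} {x} h L = begin
  x ^ᶻ (1 + 2 * h)           ≡⟨ cong (x ⊗_) (ℤP.^-*-assoc x 2 h) ⟨
  x ⊗ (x ^ᶻ 2) ^ᶻ h          ≈⟨ mod-*ˡ x (mod-^ x²≡1 h) ⟩
  x ⊗ (+ 1) ^ᶻ h             ≡⟨ cong (x ⊗_) (ℤP.^-zeroˡ h) ⟩
  x ⊗ + 1                    ≡⟨ ℤP.*-identityʳ x ⟩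
  x                          ≈⟨ L ⟩
  + 1 ⊕ + 8 ⊗ P ⊗ b          ∎
  where
  open mod-Reasoning (+ 16 ⊗ P)
  x²≡1 : x ^ᶻ 2 ≡ + 1 mod + 16 ⊗ P
  x²≡1 = subst (_≡ + 1 mod + 16 ⊗ P) (cong (x ⊗_) (sym (ℤP.*-identityʳ x))) (lifted-square-one L)

lift-iterate : ∀ n {b x} → Lifted (+ 1) b x → Lifted ((+ 2) ^ᶻ n) b (x ^ᶻ (2 ^ n))
lift-iterate zero    {b} {x} L = subst (Lifted (+ 1) b) (sym (ℤP.^-identityʳ x)) L
lift-iterate (suc n) {b} {x} L = subst (Lifted ((+ 2) ^ᶻ suc n) b) squares (square-lift (lift-iterate n L))
  where
  p = 2 ^ n
  squares : x ^ᶻ p ⊗ x ^ᶻ p ≡ x ^ᶻ (2 * p)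
  squares = sym (trans (ℤP.^-distribˡ-+-* x p (p + 0)) (cong (λ e → x ^ᶻ p ⊗ x ^ᶻ e) (ℕP.+-identityʳ p)))

lifted-power : ∀ {x b} n h → x ⊗ x ≡ + 1 ⊕ + 8 ⊗ b →
  Lifted ((+ 2) ^ᶻ n) b (x ^ᶻ (2 ^ suc n * (1 + 2 * h)))
lifted-power {x} {b} n h x²≡ =
  subst (Lifted ((+ 2) ^ᶻ n) b) exponents (lifted-odd-power h (lift-iterate n (≡⇒≡mod x²≡)))
  where
  exponents : ((x ⊗ x) ^ᶻ 2 ^ n) ^ᶻ (1 + 2 * h) ≡ x ^ᶻ (2 ^ suc n * (1 + 2 * h))
  exponents = begin
    ((x ⊗ x) ^ᶻ 2 ^ n) ^ᶻ (1 + 2 * h)    ≡⟨ cong (λ y → ((x ⊗ y) ^ᶻ 2 ^ n) ^ᶻ (1 + 2 * h)) (ℤP.*-identityʳ x) ⟨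
    ((x ^ᶻ 2) ^ᶻ 2 ^ n) ^ᶻ (1 + 2 * h)   ≡⟨ cong (_^ᶻ (1 + 2 * h)) (ℤP.^-*-assoc x 2 (2 ^ n)) ⟩
    (x ^ᶻ (2 * 2 ^ n)) ^ᶻ (1 + 2 * h)    ≡⟨ ℤP.^-*-assoc x (2 * 2 ^ n) (1 + 2 * h) ⟩
    x ^ᶻ (2 ^ suc n * (1 + 2 * h))       ∎
    where open ≡-Reasoning

-- Write Q = 2^n.  If k = 2^(n+1)·(2h + 1), the equation forces
--   a·(m + 8Q·Σ_{i<m} tri i) ≡ 1 + 8Q·tri m  (mod 16Q),
-- since every (2i + 1)^k ≡ 1 + 8Q·tri i (mod 16Q).
even-exponent-congruence : ∀ a m n h →
  a * T (2 ^ suc n * (1 + 2 * h)) m ≡ (2 * m + 1) ^ (2 ^ suc n * (1 + 2 * h)) →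
  + a ⊗ (+ m ⊕ + 8 ⊗ (+ 2) ^ᶻ n ⊗ ∑ triangle m) ≡ + 1 ⊕ + 8 ⊗ (+ 2) ^ᶻ n ⊗ triangle m mod + 16 ⊗ (+ 2) ^ᶻ n
even-exponent-congruence a m n h eqn = begin
  + a ⊗ (+ m ⊕ + 8 ⊗ Q ⊗ ∑ triangle m)   ≈⟨ mod-*ˡ (+ a) (mod-sym sum-congruence) ⟩
  + a ⊗ ∑ f m                            ≡⟨ equation-in-ℤ a k m eqn ⟩
  f m                                    ≈⟨ power-congruence m ⟩
  + 1 ⊕ + 8 ⊗ Q ⊗ triangle m             ∎
  where
  open mod-Reasoning (+ 16 ⊗ (+ 2) ^ᶻ n)
  k = 2 ^ suc n * (1 + 2 * h)
  Q = (+ 2) ^ᶻ n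
  f : ℕ → ℤ
  f i = odd i ^ᶻ k
  power-congruence : ∀ i → Lifted Q (triangle i) (f i)
  power-congruence i = lifted-power n h (odd-square i)
  sum-congruence : ∑ f m ≡ + m ⊕ + 8 ⊗ Q ⊗ ∑ triangle m mod + 16 ⊗ Q
  sum-congruence = mod-trans (∑-cong-mod f _ m (λ i _ → power-congruence i))
    (≡⇒≡mod (trans (∑-affine (+ 1) (+ 8 ⊗ Q) triangle m) (cong (_⊕ + 8 ⊗ Q ⊗ ∑ triangle m) (ℤP.*-identityʳ (+ m)))))

-- In that congruence m must be odd: modulo 2 the left side is even, the right side odd.
m-odd : ∀ {a m P S t} → + a ⊗ (+ m ⊕ + 8 ⊗ P ⊗ S) ≡ + 1 ⊕ + 8 ⊗ P ⊗ t mod + 16 ⊗ P →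
  Σ ℕ (λ j → m ≡ 1 + 2 * j)
m-odd {a} {m} {P} {S} {t} C with even-or-odd m
... | j , inj₂ m≡1+2j = j , m≡1+2j
... | j , inj₁ refl   = ⊥-elim (no-divisor-of-one (s≤s (s≤s z≤n)) 2∣1)
  where
  2∣lhs : + 2 ∣ + a ⊗ (+ (2 * j) ⊕ + 8 ⊗ P ⊗ S)
  2∣lhs = divides (+ a ⊗ (+ j ⊕ + 4 ⊗ P ⊗ S))
    (trans (cong (λ M → + a ⊗ (M ⊕ + 8 ⊗ P ⊗ S)) (ℤP.pos-* 2 j)) (regroup (+ a) (+ j) P S))
    where
    regroup : ∀ A J P S → A ⊗ (+ 2 ⊗ J ⊕ + 8 ⊗ P ⊗ S) ≡ A ⊗ (J ⊕ + 4 ⊗ P ⊗ S) ⊗ + 2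
    regroup A J P S = solve (A ∷ J ∷ P ∷ S ∷ [])
  rhs≡1 : + 1 ⊕ + 8 ⊗ P ⊗ t ≡ + 1 mod + 2
  rhs≡1 = subst (_≡ + 1 mod + 2) (regroup P t) (mod-multiple (+ 1) (+ 4 ⊗ P ⊗ t) (+ 2))
    where
    regroup : ∀ P t → + 1 ⊕ + 4 ⊗ P ⊗ t ⊗ + 2 ≡ + 1 ⊕ + 8 ⊗ P ⊗ t
    regroup P t = solve (P ∷ t ∷ [])
  2∣16P : + 2 ∣ + 16 ⊗ P
  2∣16P = divides (+ 8 ⊗ P) (solve (P ∷ []))
  2∣1 : + 2 ∣ + 1
  2∣1 = ∣-respects-mod 2∣lhs (mod-trans (mod-divisor 2∣16P C) rhs≡1)

-- For odd m the sum of triangular numbers drops out (it is even), leaving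
--   am - 1 ≡ 8Q·tri m  (mod 16Q).
reduced-congruence : ∀ {a m P j} → m ≡ 1 + 2 * j →
  + a ⊗ (+ m ⊕ + 8 ⊗ P ⊗ ∑ triangle m) ≡ + 1 ⊕ + 8 ⊗ P ⊗ triangle m mod + 16 ⊗ P →
  + a ⊗ + m ⊝ + 1 ≡ + 8 ⊗ P ⊗ triangle m mod + 16 ⊗ P
reduced-congruence {a} {m} {P} {j} refl C with triangle-sum-even j
... | divides s ∑≡2s = begin
  + a ⊗ + m ⊝ + 1                                ≈⟨ mod-+ʳ (- + 1) (mod-sym drop-sum) ⟩
  + a ⊗ (+ m ⊕ + 8 ⊗ P ⊗ ∑ triangle m) ⊝ + 1     ≈⟨ mod-+ʳ (- + 1) C ⟩
  + 1 ⊕ + 8 ⊗ P ⊗ triangle m ⊝ + 1               ≡⟨ cancel-one (+ 8 ⊗ P ⊗ triangle m) ⟩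
  + 8 ⊗ P ⊗ triangle m                           ∎
  where
  open mod-Reasoning (+ 16 ⊗ P)
  cancel-one : ∀ X → + 1 ⊕ X ⊝ + 1 ≡ X
  cancel-one X = solve (X ∷ [])
  regroup : ∀ A M P s → A ⊗ M ⊕ A ⊗ s ⊗ (+ 16 ⊗ P) ≡ A ⊗ (M ⊕ + 8 ⊗ P ⊗ (s ⊗ + 2))
  regroup A M P s = solve (A ∷ M ∷ P ∷ s ∷ [])
  drop-sum : + a ⊗ (+ m ⊕ + 8 ⊗ P ⊗ ∑ triangle m) ≡ + a ⊗ + m mod + 16 ⊗ P
  drop-sum = subst (_≡ + a ⊗ + m mod + 16 ⊗ P)
    (trans (regroup (+ a) (+ m) P s) (cong (λ S → + a ⊗ (+ m ⊕ + 8 ⊗ P ⊗ S)) (sym ∑≡2s)))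
    (mod-multiple (+ a ⊗ + m) (+ a ⊗ s) (+ 16 ⊗ P))

residue-mod4 : ∀ a → + a ≡ + (a % 4) mod + 4
residue-mod4 a = subst (_≡ + (a % 4) mod + 4) (sym a≡) (mod-multiple (+ (a % 4)) (+ (a / 4)) (+ 4))
  where
  a≡ : + a ≡ + (a % 4) ⊕ + (a / 4) ⊗ + 4
  a≡ = trans (cong +_ (ℕDivMod.m≡m%n+[m/n]*n a 4)) (trans (ℤP.pos-+ (a % 4) _) (cong (+ (a % 4) ⊕_) (ℤP.pos-* (a / 4) 4)))

residue-c+4r : ∀ c r → + (c + 4 * r) ≡ + c mod + 4
residue-c+4r c r = subst (_≡ + c mod + 4) (sym (trans (pos-c+4r c r) (cong (+ c ⊕_) (ℤP.*-comm (+ 4) (+ r)))))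
                         (mod-multiple (+ c) (+ r) (+ 4))

not-inverse-mod4 : ∀ {x y} → x ≡ + 3 mod + 4 → y ≡ + 1 mod + 4 → ¬ (x ⊗ y ≡ + 1 mod + 4)
not-inverse-mod4 x≡3 y≡1 xy≡1 = 4∤2 (∣⇒∣ᵤ (difference (mod-trans (mod-sym (mod-* x≡3 y≡1)) xy≡1)))
  where
  4∤2 : ¬ (4 ∣ℕ 2)
  4∤2 4∣2 = ℕP.<⇒≱ (s≤s (s≤s (s≤s z≤n))) (ℕDiv.∣⇒≤ 4∣2)

product≡1-mod4 : ∀ {x P X} → x ⊝ + 1 ≡ + 8 ⊗ P ⊗ X mod + 16 ⊗ P → x ≡ + 1 mod + 4
product≡1-mod4 {x} {P} {X} D≡ = mod-intro (∣-respects-mod 4∣8PX (mod-sym (mod-divisor 4∣16P D≡)))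
  where
  4∣8PX : + 4 ∣ + 8 ⊗ P ⊗ X
  4∣8PX = divides (+ 2 ⊗ P ⊗ X) (solve (P ∷ X ∷ []))
  4∣16P : + 4 ∣ + 16 ⊗ P
  4∣16P = divides (+ 4 ⊗ P) (solve (P ∷ []))

scale-mod2 : ∀ P {t c} → t ≡ c mod + 2 → + 8 ⊗ P ⊗ t ≡ + 8 ⊗ P ⊗ c mod + 16 ⊗ P
scale-mod2 P {t} {c} (mod-intro (divides u t-c≡2u)) = mod-intro (divides u (begin
  + 8 ⊗ P ⊗ t ⊝ + 8 ⊗ P ⊗ c    ≡⟨ factor P t c ⟩
  + 8 ⊗ P ⊗ (t ⊝ c)            ≡⟨ cong (+ 8 ⊗ P ⊗_) t-c≡2u ⟩
  + 8 ⊗ P ⊗ (u ⊗ + 2)          ≡⟨ regroup P u ⟩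
  u ⊗ (+ 16 ⊗ P)               ∎))
  where
  open ≡-Reasoning
  factor : ∀ P t c → + 8 ⊗ P ⊗ t ⊝ + 8 ⊗ P ⊗ c ≡ + 8 ⊗ P ⊗ (t ⊝ c)
  factor P t c = solve (P ∷ t ∷ c ∷ [])
  regroup : ∀ P u → + 8 ⊗ P ⊗ (u ⊗ + 2) ≡ u ⊗ (+ 16 ⊗ P)
  regroup P u = solve (P ∷ u ∷ [])

-- m ≡ 1 (mod 4): tri m is odd, so am - 1 ≡ 8P (mod 16P); and am ≡ 1 forces a ≢ 3 (mod 4).
case-1mod4 : ∀ {a m P} r → m ≡ 1 + 4 * r →
  + a ⊗ + m ⊝ + 1 ≡ + 8 ⊗ P ⊗ triangle m mod + 16 ⊗ P →
  (+ a ⊗ + m ⊝ + 1 ≡ + 8 ⊗ P ⊗ + 1 mod + 16 ⊗ P) × ¬ (a % 4 ≡ 3)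
case-1mod4 {a} {m} {P} r refl D≡ = mod-trans D≡ (scale-mod2 P (triangle-1mod4 r)) , a≢3
  where
  a≢3 : ¬ (a % 4 ≡ 3)
  a≢3 a%4≡3 = not-inverse-mod4 (subst (λ s → + a ≡ + s mod + 4) a%4≡3 (residue-mod4 a))
                               (residue-c+4r 1 r) (product≡1-mod4 D≡)

-- m ≡ 3 (mod 4): tri m is even, so 16P ∣ am - 1; and am ≡ 1 forces a ≢ 1 (mod 4).
case-3mod4 : ∀ {a m P} r → m ≡ 3 + 4 * r →
  + a ⊗ + m ⊝ + 1 ≡ + 8 ⊗ P ⊗ triangle m mod + 16 ⊗ P →
  (+ 16 ⊗ P ∣ + a ⊗ + m ⊝ + 1) × ¬ (a % 4 ≡ 1)
case-3mod4 {a} {m} {P} r refl D≡ = 16P∣D , a≢1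
  where
  16P∣D : + 16 ⊗ P ∣ + a ⊗ + m ⊝ + 1
  16P∣D = ∣-respects-mod (divides (+ 0) (vanish P))
                         (mod-sym (mod-trans D≡ (scale-mod2 P (triangle-3mod4 r))))
    where
    vanish : ∀ P → + 8 ⊗ P ⊗ + 0 ≡ + 0 ⊗ (+ 16 ⊗ P)
    vanish P = solve (P ∷ [])
  a≢1 : ¬ (a % 4 ≡ 1)
  a≢1 a%4≡1 = not-inverse-mod4 (residue-c+4r 3 r) (subst (λ s → + a ≡ + s mod + 4) a%4≡1 (residue-mod4 a))
                               (subst (_≡ + 1 mod + 4) (ℤP.*-comm (+ a) (+ m)) (product≡1-mod4 D≡))

2^-∣ : ∀ {i j} → i ≤ j → 2 ^ i ∣ℕ 2 ^ j
2^-∣ {i} {j} i≤j = ℕDiv.divides (2 ^ (j ∸ i)) (begin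
  2 ^ j                  ≡⟨ cong (2 ^_) (ℕP.m+[n∸m]≡n i≤j) ⟨
  2 ^ (i + (j ∸ i))      ≡⟨ ℕP.^-distribˡ-+-* 2 i (j ∸ i) ⟩
  2 ^ i * 2 ^ (j ∸ i)    ≡⟨ ℕP.*-comm (2 ^ i) _ ⟩
  2 ^ (j ∸ i) * 2 ^ i    ∎)
  where open ≡-Reasoning

valuation-≥ : ∀ {X u w} → 2 ^ u ∣ℕ X → Ord2 X w → u ≤ w
valuation-≥ {X} {u} {w} 2^u∣X (_ , 2^w+1∤X) with u ≤? w
... | yes u≤w = u≤w
... | no  u≰w = ⊥-elim (2^w+1∤X (ℕDiv.∣-trans (2^-∣ (ℕP.≰⇒> u≰w)) 2^u∣X))

valuation-unique : ∀ {X u w} → Ord2 X u → Ord2 X w → w ≡ u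
valuation-unique ord-u ord-w = ℕP.≤-antisym (valuation-≥ (proj₁ ord-w) ord-u) (valuation-≥ (proj₁ ord-u) ord-w)

exact-valuation : ∀ {X j} → + X ≡ + (2 ^ j) mod + (2 ^ suc j) → Ord2 X j
exact-valuation {X} {j} X≡2^j = ∣⇒∣ᵤ 2^j∣X , 2^j+1∤X
  where
  2^j∣2^j+1 : + (2 ^ j) ∣ + (2 ^ suc j)
  2^j∣2^j+1 = divides (+ 2) (ℤP.pos-* 2 (2 ^ j))
  2^j∣X : + (2 ^ j) ∣ + X
  2^j∣X = ∣-respects-mod ∣-refl (mod-divisor 2^j∣2^j+1 (mod-sym X≡2^j))
  2^j+1∤X : ¬ (2 ^ suc j ∣ℕ X)
  2^j+1∤X 2^j+1∣X = ℕP.<⇒≱ (ℕP.^-monoʳ-< 2 (s≤s (s≤s z≤n)) (ℕP.n<1+n j))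
    (ℕDiv.∣⇒≤ {{ℕP.m^n≢0 2 j}} (∣⇒∣ᵤ (∣-respects-mod (∣ᵤ⇒∣ 2^j+1∣X) X≡2^j)))

odd-part : ∀ {k v} → Ord2 k v → Σ ℕ (λ h → k ≡ 2 ^ v * (1 + 2 * h))
odd-part {k} {v} (ℕDiv.divides q k≡q2^v , 2^v+1∤k) with even-or-odd q
... | h , inj₁ refl = ⊥-elim (2^v+1∤k (ℕDiv.divides h (trans k≡q2^v (regroup h (2 ^ v)))))
  where
  regroup : ∀ h p → 2 * h * p ≡ h * (2 * p)
  regroup h p = ℕSolver.solve (h ∷ p ∷ [])
... | h , inj₂ refl = h , trans k≡q2^v (ℕP.*-comm (1 + 2 * h) (2 ^ v))

even-exponent-case : ∀ a m n h → 1 ≤ a → 1 < m →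
  a * T (2 ^ suc n * (1 + 2 * h)) m ≡ (2 * m + 1) ^ (2 ^ suc n * (1 + 2 * h)) →
  (Ord2 (a * m ∸ 1) (3 + n) × ¬ (a % 4 ≡ 3)) ⊎ (2 ^ (4 + n) ∣ℕ a * m ∸ 1 × ¬ (a % 4 ≡ 1))
even-exponent-case a m n h 1≤a 1<m eqn = classify (m-odd {a = a} {P = Q} {S = ∑ triangle m} {t = triangle m} C)
  where
  Q = (+ 2) ^ᶻ n
  C : + a ⊗ (+ m ⊕ + 8 ⊗ Q ⊗ ∑ triangle m) ≡ + 1 ⊕ + 8 ⊗ Q ⊗ triangle m mod + 16 ⊗ Q
  C = even-exponent-congruence a m n h eqn
  D≡8Qtri : ∀ {j} → m ≡ 1 + 2 * j → + a ⊗ + m ⊝ + 1 ≡ + 8 ⊗ Q ⊗ triangle m mod + 16 ⊗ Q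
  D≡8Qtri {j} m≡ = reduced-congruence {a = a} {P = Q} {j = j} m≡ C
  D≡ : + a ⊗ + m ⊝ + 1 ≡ + (a * m ∸ 1)
  D≡ = sym (trans (pos-pred (ℕP.*-mono-≤ 1≤a (ℕP.<⇒≤ 1<m))) (cong (_⊝ + 1) (ℤP.pos-* a m)))
  8Q≡ : + 8 ⊗ Q ⊗ + 1 ≡ + (2 ^ (3 + n))
  8Q≡ = trans (scale Q) (sym (pos-^ 2 (3 + n)))
    where
    scale : ∀ Q → + 8 ⊗ Q ⊗ + 1 ≡ + 2 ⊗ (+ 2 ⊗ (+ 2 ⊗ Q))
    scale Q = solve (Q ∷ [])
  16Q≡ : + 16 ⊗ Q ≡ + (2 ^ (4 + n))
  16Q≡ = trans (scale Q) (sym (pos-^ 2 (4 + n)))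
    where
    scale : ∀ Q → + 16 ⊗ Q ≡ + 2 ⊗ (+ 2 ⊗ (+ 2 ⊗ (+ 2 ⊗ Q)))
    scale Q = solve (Q ∷ [])
  classify : Σ ℕ (λ j → m ≡ 1 + 2 * j) →
    (Ord2 (a * m ∸ 1) (3 + n) × ¬ (a % 4 ≡ 3)) ⊎ (2 ^ (4 + n) ∣ℕ a * m ∸ 1 × ¬ (a % 4 ≡ 1))
  classify (j , m≡) with odd-mod4 j
  ... | r , inj₁ m≡1+4r = inj₁ (map₁ (λ D≡8Q → exact-valuation {j = 3 + n} (mod-rewrite D≡ 8Q≡ 16Q≡ D≡8Q))
                                    (case-1mod4 {a = a} {P = Q} r (trans m≡ m≡1+4r) (D≡8Qtri {j} m≡)))
  ... | r , inj₂ m≡3+4r = inj₂ (map₁ (λ 16Q∣D → ∣⇒∣ᵤ (subst₂ _∣_ 16Q≡ D≡ 16Q∣D))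
                                    (case-3mod4 {a = a} {P = Q} r (trans m≡ m≡3+4r) (D≡8Qtri {j} m≡)))

theorem4 : ∀ (a k m : ℕ) → 1 ≤ a → 1 ≤ k → 1 < m →
    a * T k m ≡ (2 * m + 1) ^ k →
    ∀ (v w : ℕ) → Ord2 k v → Ord2 (a * m ∸ 1) w →
    (a % 4 ≡ 1 → w ≡ 2 + v) × (a % 4 ≡ 3 → 3 + v ≤ w)
theorem4 a k m _ _ 1<m eqn zero w ord-k _ with odd-part {v = zero} ord-k
... | h , refl = ⊥-elim (odd-exponent-impossible a m h 1<m
                   (subst (λ e → a * T e m ≡ (2 * m + 1) ^ e) (ℕP.*-identityˡ (1 + 2 * h)) eqn))
theorem4 a k m 1≤a _ 1<m eqn (suc n) w ord-k ord-D with odd-part {v = suc n} ord-k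
... | h , refl = [ exact-case , divisible-case ]′ (even-exponent-case a m n h 1≤a 1<m eqn)
  where
  exact-case : Ord2 (a * m ∸ 1) (3 + n) × ¬ (a % 4 ≡ 3) → (a % 4 ≡ 1 → w ≡ 3 + n) × (a % 4 ≡ 3 → 4 + n ≤ w)
  exact-case (ord-D′ , a≢3) = (λ _ → valuation-unique ord-D′ ord-D) , (λ a≡3 → ⊥-elim (a≢3 a≡3))
  divisible-case : 2 ^ (4 + n) ∣ℕ a * m ∸ 1 × ¬ (a % 4 ≡ 1) → (a % 4 ≡ 1 → w ≡ 3 + n) × (a % 4 ≡ 3 → 4 + n ≤ w)
  divisible-case (2^n+4∣D , a≢1) = (λ a≡1 → ⊥-elim (a≢1 a≡1)) , (λ _ → valuation-≥ 2^n+4∣D ord-D)
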